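{- Let $n,k$ be positive integers with $n\ge 2k$, and let $n'=\frac{n}{\gcd(n,k)}$, $k'=\frac{k}{\gcd(n,k)}$. Then $Q(n,k)$ is isomorphic to the circular complete graph $K_{n'/k'}$.
   Context: For a positive integer $n$ let $[n]=\{1,\dots,n\}$ and let $C_n$ be the cycle on $[n]$ with edges $\{i,i+1\}$ ($1\le i\le n-1$) and $\{n,1\}$. The Schrijver graph $\mathrm{SG}(n,k)$ ($n\ge 2k$) has as vertices the $k$-subsets of $[n]$ containing no two cyclically consecutive elements, two vertices adjacent iff they are disjoint. An arc of $C_n$ is a set $\{i,i+1,\dots,i+m-1\}$ (addition mod $n$) with $1\le m\le n-1$. A set $U\subseteq[n]$ is well-spread if for any two arcs $A,B$ with $|A|=|B|$ we have $\big||A\cap U|-|B\cap U|\big|\le 1$. $Q(n,k)$ is the induced subgraph of $\mathrm{SG}(n,k)$ on all well-spread $k$-subsets of $[n]$. The circular complete graph $K_{p/q}$ has vertex set $\{0,1,\dots,p-1\}$, with $\{i,j\}$ an edge iff $q\le |i-j|\le p-q$. -}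

module Defs where

open import Data.Nat using (ℕ; zero; suc; _≤_; ∣_-_∣; _∸_)
open import Data.Fin using (Fin; zero; suc; toℕ)
open import Data.Fin.Subset using (Subset; ⁅_⁆; _∪_; _∩_; _∈_; _∉_; ∣_∣)
import Data.Fin.Subset as S
open import Data.Maybe using (Maybe; just; nothing; maybe)
import Data.Maybe as M
open import Data.Product using (Σ)
open import Relation.Binary.PropositionalEquality using (_≡_)
open import Function.Bundles using (_⤖_; _⇔_; Bijection)

-- The ground set [n] is represented by Fin n (element i ∈ [n] ↔ i-1 : Fin n).

notLast : ∀ {m} → Fin (suc m) → Maybe (Fin m)
notLast {zero} zero = nothing
notLast {suc m} zero = just zero
notLast {suc m} (suc i) = M.map suc (notLast i)

csuc : ∀ {m} → Fin m → Fin m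
csuc {suc m} i = maybe suc zero (notLast i)

arc : ∀ {n} → Fin n → ℕ → Subset n
arc i zero = S.⊥
arc i (suc m) = ⁅ i ⁆ ∪ arc (csuc i) m

CycStable : ∀ {n} → Subset n → Set
CycStable {n} U = (i : Fin n) → i ∈ U → csuc i ∉ U

WellSpread : ∀ {n} → Subset n → Set
WellSpread {n} U = (a b : Fin n) (m : ℕ) → 1 ≤ m → m ≤ n ∸ 1 →
  ∣ ∣ arc a m ∩ U ∣ - ∣ arc b m ∩ U ∣ ∣ ≤ 1

record Graph : Set₁ where
  field
    V : Set
    Adj : V → V → Set

open Graph public

Iso : Graph → Graph → Set
Iso G H = Σ (V G ⤖ V H) λ f →
  (u v : V G) → Adj G u v ⇔ Adj H (Bijection.to f u) (Bijection.to f v)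

-- vertices of Q(n,k): well-spread k-subsets with no two cyclically consecutive
-- elements (proofs irrelevant, so a vertex is determined by its underlying set)
record QVertex (n k : ℕ) : Set where
  constructor qv
  field
    set : Subset n
    .size : ∣ set ∣ ≡ k
    .stable : CycStable set
    .spread : WellSpread set

open QVertex public

Q : ℕ → ℕ → Graph
Q n k = record
  { V = QVertex n k
  ; Adj = λ u v → (x : Fin n) → x ∈ set u → x ∉ set v }

Kcirc : ℕ → ℕ → Graph
Kcirc p q = record
  { V = Fin p
  ; Adj = λ i j → q ≤ ∣ toℕ i - toℕ j ∣ × ∣ toℕ i - toℕ j ∣ ≤ p ∸ q }
  where open import Data.Product using (_×_)

{-# OPTIONS --safe #-}
module Submission where

-- Let U ⊆ ℤ/N be a well-spread k-set and P j the number of its points among 0, …, j − 1 of its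
-- periodic extension, so P (j + N) = P j + k. Covering l·N points by N consecutive arcs of
-- length l, which all meet U in c or c + 1 points, gives k·l < N·(P (x + l) − P x + 1). If x₀
-- maximises N·P x − k·x, then also N·(P (x₀ + d) − P x₀) ≤ k·d, so P (x₀ + d) − P x₀ = ⌊k·d/N⌋
-- and U is a rotation of the mechanical word {x : (k·x + τ) mod N ≥ N − k}. After dividing N and k
-- by g = gcd N k these are the n' sets Can τ, τ < n', each of which is a vertex. As k' is a unit
-- mod n', a statement about the points of Can s and Can t becomes one about residues u and u + (t − s)
-- mod n', and then Can s, Can t are disjoint iff k' ≤ |s − t| ≤ n' − k', and equal iff s = t.

open import Defs
open import Data.Nat
open import Data.Nat.Properties
open import Data.Nat.DivMod
open import Data.Nat.GCD using (gcd; gcd-comm; gcd[m,n]≢0; c*gcd[m,n]≡gcd[cm,cn]; module Bézout)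
open import Data.Nat.Coprimality using (coprime-Bézout; gcd≡1⇒coprime)
open import Data.Nat.Tactic.RingSolver using (solve-∀)
open import Data.Bool using (Bool; true; false; _∧_) renaming (_≟_ to _≟ᵇ_)
open import Data.Bool.Properties using (T-≡)
open import Data.Fin using (Fin; zero; suc; toℕ; fromℕ<)
import Data.Fin.Properties as FP
open import Data.Fin.Subset using (Subset; ⁅_⁆; _∪_; _∩_; _∈_; _∉_; ∣_∣)
import Data.Fin.Subset as S
import Data.Fin.Subset.Properties as SP
open import Data.Vec using (_∷_; []; lookup; tabulate)
import Data.Vec.Properties as VP
open import Data.Maybe using (just; nothing)
import Data.Maybe as M
open import Data.Product
open import Data.Empty using (⊥-elim)
open import Data.Sum using (_⊎_; inj₁; inj₂)
open import Function.Base using (_∘′_)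
open import Function.Bundles using (Equivalence; _⇔_; mk⇔; mk⤖)
import Function.Properties.Equivalence as ⇔
open import Relation.Nullary using (¬_; Dec; yes; no; contradiction)
open import Relation.Nullary.Decidable.Core using (recompute)
open import Relation.Binary.PropositionalEquality

bit : Bool → ℕ
bit true = 1
bit false = 0

≤⇒≤ᵇ≡true : ∀ {m n} → m ≤ n → (m ≤ᵇ n) ≡ true
≤⇒≤ᵇ≡true m≤n = Equivalence.to T-≡ (≤⇒≤ᵇ m≤n)

≤ᵇ≡true⇒≤ : ∀ {m n} → (m ≤ᵇ n) ≡ true → m ≤ n
≤ᵇ≡true⇒≤ {m} {n} eq = ≤ᵇ⇒≤ m n (Equivalence.from T-≡ eq)

≰⇒≤ᵇ≡false : ∀ {m n} → ¬ m ≤ n → (m ≤ᵇ n) ≡ false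
≰⇒≤ᵇ≡false {m} {n} m≰n with m ≤ᵇ n in eq
... | false = refl
... | true = contradiction (≤ᵇ≡true⇒≤ eq) m≰n

[m*o≤ᵇn*o]≡[m≤ᵇn] : ∀ m n o .{{_ : NonZero o}} → (m * o ≤ᵇ n * o) ≡ (m ≤ᵇ n)
[m*o≤ᵇn*o]≡[m≤ᵇn] m n o with m ≤? n
... | yes m≤n = trans (≤⇒≤ᵇ≡true (*-monoˡ-≤ o m≤n)) (sym (≤⇒≤ᵇ≡true m≤n))
... | no m≰n = trans (≰⇒≤ᵇ≡false (m≰n ∘′ *-cancelʳ-≤ m n o)) (sym (≰⇒≤ᵇ≡false m≰n))

∣m-n∣≤o⇒m≤n+o : ∀ m n {o} → ∣ m - n ∣ ≤ o → m ≤ n + o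
∣m-n∣≤o⇒m≤n+o m n h = ≤-trans (m≤n+∣m-n∣ m n) (+-monoʳ-≤ n h)

∣m-n∣≤o : ∀ m n {o} → m ≤ n + o → n ≤ m + o → ∣ m - n ∣ ≤ o
∣m-n∣≤o m n {o} m≤n+o n≤m+o with ∣m-n∣≡[m∸n]∨[n∸m] m n
... | inj₁ eq = subst (_≤ o) (sym eq) (m≤n+o⇒m∸n≤o m n m≤n+o)
... | inj₂ eq = subst (_≤ o) (sym eq) (m≤n+o⇒m∸n≤o n m n≤m+o)

[m%d+n]%d≡[m+n]%d : ∀ m n d .{{_ : NonZero d}} → (m % d + n) % d ≡ (m + n) % d
[m%d+n]%d≡[m+n]%d m n d = begin
  (m % d + n) % d         ≡⟨ %-distribˡ-+ (m % d) n d ⟩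
  (m % d % d + n % d) % d ≡⟨ cong (λ z → (z + n % d) % d) (m%n%n≡m%n m d) ⟩
  (m % d + n % d) % d     ≡⟨ %-distribˡ-+ m n d ⟨
  (m + n) % d             ∎
  where open ≡-Reasoning

[m+n%d]%d≡[m+n]%d : ∀ m n d .{{_ : NonZero d}} → (m + n % d) % d ≡ (m + n) % d
[m+n%d]%d≡[m+n]%d m n d = begin
  (m + n % d) % d ≡⟨ cong (_% d) (+-comm m (n % d)) ⟩
  (n % d + m) % d ≡⟨ [m%d+n]%d≡[m+n]%d n m d ⟩
  (n + m) % d     ≡⟨ cong (_% d) (+-comm n m) ⟩
  (m + n) % d     ∎
  where open ≡-Reasoning

[m*n]%d≡[m%d*n]%d : ∀ m n d .{{_ : NonZero d}} → (m * n) % d ≡ ((m % d) * n) % d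
[m*n]%d≡[m%d*n]%d m n d = begin
  (m * n) % d               ≡⟨ %-distribˡ-* m n d ⟩
  (m % d * (n % d)) % d     ≡⟨ cong (λ z → (z * (n % d)) % d) (m%n%n≡m%n m d) ⟨
  (m % d % d * (n % d)) % d ≡⟨ %-distribˡ-* (m % d) n d ⟨
  (m % d * n) % d           ∎
  where open ≡-Reasoning

n≤m<2n⇒m%n≡m∸n : ∀ {m n} .{{_ : NonZero n}} → n ≤ m → m < n + n → m % n ≡ m ∸ n
n≤m<2n⇒m%n≡m∸n {m} {n} n≤m m<2n = begin
  m % n           ≡⟨ cong (_% n) (m∸n+n≡m n≤m) ⟨
  (m ∸ n + n) % n ≡⟨ [m+n]%n≡m%n (m ∸ n) n ⟩
  (m ∸ n) % n     ≡⟨ m<n⇒m%n≡m (subst (m ∸ n <_) (m+n∸n≡m n n) (∸-monoˡ-< m<2n n≤m)) ⟩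
  m ∸ n           ∎
  where open ≡-Reasoning

[m+o]%n≢m%n : ∀ m o n .{{_ : NonZero n}} → 0 < o → o < n → (m + o) % n ≢ m % n
[m+o]%n≢m%n m o n 0<o o<n eq with m % n + o <? n
... | yes r+o<n = <-irrefl refl (subst (m % n <_) r+o≡r (m<m+n (m % n) 0<o))
  where
    r+o≡r : m % n + o ≡ m % n
    r+o≡r = trans (sym (m<n⇒m%n≡m r+o<n)) (trans ([m%d+n]%d≡[m+n]%d m o n) eq)
... | no r+o≮n = <-irrefl refl (subst (_< n) o≡n o<n)
  where
    r = m % n
    n≤r+o : n ≤ r + o
    n≤r+o = ≮⇒≥ r+o≮n
    r+o∸n≡r : r + o ∸ n ≡ r
    r+o∸n≡r = trans (sym (n≤m<2n⇒m%n≡m∸n n≤r+o (+-mono-< (m%n<n m n) o<n)))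
                    (trans ([m%d+n]%d≡[m+n]%d m o n) eq)
    o≡n : o ≡ n
    o≡n = +-cancelˡ-≡ r o n (trans (sym (m∸n+n≡m n≤r+o)) (cong (_+ n) r+o∸n≡r))

c*N+x%N≡x : ∀ N .{{_ : NonZero N}} x c → N * c ≤ x → x < N * c + N → c * N + x % N ≡ x
c*N+x%N≡x N x c Nc≤x x<Nc+N = begin
  c * N + x % N ≡⟨ cong (λ z → c * N + z % N) x≡r+c*N ⟩
  c * N + (r + c * N) % N ≡⟨ cong (c * N +_) ([m+kn]%n≡m%n r c N) ⟩
  c * N + r % N ≡⟨ cong (c * N +_) (m<n⇒m%n≡m r<N) ⟩
  c * N + r ≡⟨ +-comm (c * N) r ⟩
  r + c * N ≡⟨ x≡r+c*N ⟨
  x ∎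
  where
    open ≡-Reasoning
    r = x ∸ N * c
    x≡r+c*N : x ≡ r + c * N
    x≡r+c*N = trans (sym (m∸n+n≡m Nc≤x)) (cong (r +_) (*-comm N c))
    r<N : r < N
    r<N = m<n+o⇒m∸n<o x (N * c) x<Nc+N

floor-step-bit : ∀ N k r c b →
  N * (c + bit b) ≤ c * N + r + k → c * N + r + k < N * (c + bit b) + N →
  b ≡ (N ∸ k ≤ᵇ r)
floor-step-bit N k r c true lo _ =
  sym (≤⇒≤ᵇ≡true (m≤n+o⇒m∸n≤o N k (+-cancelˡ-≤ (c * N) _ _ (begin
    c * N + N       ≡⟨ c*N+N≡N*[c+1] c N ⟩
    N * (c + 1)     ≤⟨ lo ⟩
    c * N + r + k   ≡⟨ +-assoc (c * N) r k ⟩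
    c * N + (r + k) ≡⟨ cong (c * N +_) (+-comm r k) ⟩
    c * N + (k + r) ∎))))
  where
    open ≤-Reasoning
    c*N+N≡N*[c+1] : ∀ c N → c * N + N ≡ N * (c + 1)
    c*N+N≡N*[c+1] = solve-∀
floor-step-bit N k r c false _ hi = sym (≰⇒≤ᵇ≡false λ N∸k≤r → <-irrefl refl (begin-strict
  N           ≤⟨ m≤n+m∸n N k ⟩
  k + (N ∸ k) ≤⟨ +-monoʳ-≤ k N∸k≤r ⟩
  k + r       <⟨ k+r<N ⟩
  N           ∎))
  where
    open ≤-Reasoning
    c*N+r+k≡c*N+[k+r] : ∀ c N r k → c * N + r + k ≡ c * N + (k + r)
    c*N+r+k≡c*N+[k+r] = solve-∀
    N*[c+0]+N≡c*N+N : ∀ c N → N * (c + 0) + N ≡ c * N + N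
    N*[c+0]+N≡c*N+N = solve-∀
    k+r<N : k + r < N
    k+r<N = +-cancelˡ-< (c * N) _ _ (begin-strict
      c * N + (k + r) ≡⟨ c*N+r+k≡c*N+[k+r] c N r k ⟨
      c * N + r + k   <⟨ hi ⟩
      N * (c + 0) + N ≡⟨ N*[c+0]+N≡c*N+N c N ⟩
      c * N + N       ∎)

quotients-close : ∀ n K {c c′ r r′ s s′} → r < n → s′ < n →
  c * n + r′ ≡ K + r → c′ * n + s′ ≡ K + s → c ≤ c′ + 1
quotients-close n K {c} {c′} {r} {r′} {s} {s′} r<n s′<n eq eq′ =
  s≤s⁻¹ (subst (suc c ≤_) (+-suc c′ 1) (*-cancelʳ-< n c (c′ + 2) (begin-strict
    c * n                ≤⟨ m≤m+n (c * n) r′ ⟩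
    c * n + r′           ≡⟨ eq ⟩
    K + r                <⟨ +-monoʳ-< K r<n ⟩
    K + n                ≤⟨ +-monoˡ-≤ n (m≤m+n K s) ⟩
    K + s + n            ≡⟨ cong (_+ n) eq′ ⟨
    c′ * n + s′ + n      <⟨ +-monoˡ-< n (+-monoʳ-< (c′ * n) s′<n) ⟩
    c′ * n + n + n       ≡⟨ c*n+n+n≡[c+2]*n c′ n ⟩
    (c′ + 2) * n         ∎)))
  where
    open ≤-Reasoning
    c*n+n+n≡[c+2]*n : ∀ c n → c * n + n + n ≡ (c + 2) * n
    c*n+n+n≡[c+2]*n = solve-∀

*-inverse-mod : ∀ k a → gcd k (suc a) ≡ 1 → ∃ λ u → (k * u) % suc a ≡ 1 % suc a
*-inverse-mod k a coprime with coprime-Bézout (gcd≡1⇒coprime coprime)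
... | Bézout.+- x y eq = x , (begin
  (k * x) % suc a             ≡⟨ cong (_% suc a) (*-comm k x) ⟩
  (x * k) % suc a             ≡⟨ cong (_% suc a) eq ⟨
  (1 + y * suc a) % suc a     ≡⟨ [m+kn]%n≡m%n 1 y (suc a) ⟩
  1 % suc a                   ∎)
  where open ≡-Reasoning
... | Bézout.-+ x y eq = x * a , (begin
  (k * (x * a)) % suc a          ≡⟨ [m+n]%n≡m%n (k * (x * a)) (suc a) ⟨
  (k * (x * a) + suc a) % suc a  ≡⟨ cong (_% suc a) (k*[x*a]+1+a≡[1+x*k]*a+1 k x a) ⟩
  ((1 + x * k) * a + 1) % suc a  ≡⟨ cong (λ z → (z * a + 1) % suc a) eq ⟩
  (y * suc a * a + 1) % suc a    ≡⟨ cong (_% suc a) (y*n*a+1≡1+y*a*n y a) ⟩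
  (1 + y * a * suc a) % suc a    ≡⟨ [m+kn]%n≡m%n 1 (y * a) (suc a) ⟩
  1 % suc a                      ∎)
  where
    open ≡-Reasoning
    k*[x*a]+1+a≡[1+x*k]*a+1 : ∀ k x a → k * (x * a) + suc a ≡ (1 + x * k) * a + 1
    k*[x*a]+1+a≡[1+x*k]*a+1 = solve-∀
    y*n*a+1≡1+y*a*n : ∀ y a → y * suc a * a + 1 ≡ 1 + y * a * suc a
    y*n*a+1≡1+y*a*n = solve-∀

*-surjective-mod : ∀ k a → gcd k (suc a) ≡ 1 → ∀ ρ → ∃ λ u → (k * u) % suc a ≡ ρ % suc a
*-surjective-mod k a coprime ρ = v * ρ , (begin
  (k * (v * ρ)) % suc a        ≡⟨ cong (_% suc a) (*-assoc k v ρ) ⟨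
  (k * v * ρ) % suc a          ≡⟨ [m*n]%d≡[m%d*n]%d (k * v) ρ (suc a) ⟩
  ((k * v) % suc a * ρ) % suc a ≡⟨ cong (λ z → (z * ρ) % suc a) kv≡1 ⟩
  (1 % suc a * ρ) % suc a      ≡⟨ [m*n]%d≡[m%d*n]%d 1 ρ (suc a) ⟨
  (1 * ρ) % suc a              ≡⟨ cong (_% suc a) (*-identityˡ ρ) ⟩
  ρ % suc a                    ∎)
  where
    open ≡-Reasoning
    v = proj₁ (*-inverse-mod k a coprime)
    kv≡1 = proj₂ (*-inverse-mod k a coprime)

lookup-∈ : ∀ {n} {p : Subset n} {x} → x ∈ p → lookup p x ≡ true
lookup-∈ = VP.[]=⇒lookup

∈-lookup : ∀ {n} {p : Subset n} {x} → lookup p x ≡ true → x ∈ p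
∈-lookup {p = p} {x} = VP.lookup⇒[]= x p

lookup-∉ : ∀ {n} {p : Subset n} {x} → x ∉ p → lookup p x ≡ false
lookup-∉ {p = p} {x} x∉p with lookup p x in eq
... | true = contradiction (∈-lookup eq) x∉p
... | false = refl

subset-ext : ∀ {n} {p q : Subset n} → (∀ x → lookup p x ≡ lookup q x) → p ≡ q
subset-ext {p = p} {q} h = begin
  p                  ≡⟨ VP.tabulate∘lookup p ⟨
  tabulate (lookup p) ≡⟨ VP.tabulate-cong h ⟩
  tabulate (lookup q) ≡⟨ VP.tabulate∘lookup q ⟩
  q                  ∎
  where open ≡-Reasoning

inclusion-exclusion : ∀ {n} (p q r : Subset n) →
  ∣ (p ∪ q) ∩ r ∣ + ∣ p ∩ (q ∩ r) ∣ ≡ ∣ p ∩ r ∣ + ∣ q ∩ r ∣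
inclusion-exclusion [] [] [] = refl
inclusion-exclusion (true ∷ p) (true ∷ q) (false ∷ r) = inclusion-exclusion p q r
inclusion-exclusion (true ∷ p) (false ∷ q) (false ∷ r) = inclusion-exclusion p q r
inclusion-exclusion (false ∷ p) (true ∷ q) (false ∷ r) = inclusion-exclusion p q r
inclusion-exclusion (false ∷ p) (false ∷ q) (false ∷ r) = inclusion-exclusion p q r
inclusion-exclusion (false ∷ p) (false ∷ q) (true ∷ r) = inclusion-exclusion p q r
inclusion-exclusion (true ∷ p) (false ∷ q) (true ∷ r) = cong suc (inclusion-exclusion p q r)
inclusion-exclusion (false ∷ p) (true ∷ q) (true ∷ r) =
  trans (cong suc (inclusion-exclusion p q r)) (sym (+-suc _ _))
inclusion-exclusion (true ∷ p) (true ∷ q) (true ∷ r) = begin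
  suc (a + suc b) ≡⟨ cong suc (+-suc a b) ⟩
  suc (suc (a + b)) ≡⟨ cong (suc ∘′ suc) (inclusion-exclusion p q r) ⟩
  suc (suc (c + d)) ≡⟨ cong suc (+-suc c d) ⟨
  suc (c + suc d) ∎
  where
    open ≡-Reasoning
    a = ∣ (p ∪ q) ∩ r ∣
    b = ∣ p ∩ (q ∩ r) ∣
    c = ∣ p ∩ r ∣
    d = ∣ q ∩ r ∣

∣⊥∩p∣≡0 : ∀ {n} (p : Subset n) → ∣ S.⊥ ∩ p ∣ ≡ 0
∣⊥∩p∣≡0 {n} p = trans (cong ∣_∣ (SP.∩-zeroˡ p)) (SP.∣⊥∣≡0 n)

∣⁅x⁆∩p∣≡bit[x∈p] : ∀ {n} (x : Fin n) (p : Subset n) → ∣ ⁅ x ⁆ ∩ p ∣ ≡ bit (lookup p x)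
∣⁅x⁆∩p∣≡bit[x∈p] zero (true ∷ p) = cong suc (∣⊥∩p∣≡0 p)
∣⁅x⁆∩p∣≡bit[x∈p] zero (false ∷ p) = ∣⊥∩p∣≡0 p
∣⁅x⁆∩p∣≡bit[x∈p] (suc x) (b ∷ p) = ∣⁅x⁆∩p∣≡bit[x∈p] x p

toℕ-mod : ∀ m n .{{_ : NonZero n}} → toℕ (m mod n) ≡ m % n
toℕ-mod m n = FP.toℕ-fromℕ< (m%n<n m n)

toℕ-mod-toℕ : ∀ {n} (x : Fin (suc n)) → toℕ x mod suc n ≡ x
toℕ-mod-toℕ {n} x = FP.toℕ-injective (trans (toℕ-mod (toℕ x) (suc n)) (m<n⇒m%n≡m (FP.toℕ<n x)))

data LastView {m} (i : Fin (suc m)) : Set where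
  last  : toℕ i ≡ m → notLast i ≡ nothing → LastView i
  below : (j : Fin m) → toℕ j ≡ toℕ i → notLast i ≡ just j → LastView i

lastView : ∀ {m} (i : Fin (suc m)) → LastView i
lastView {zero} zero = last refl refl
lastView {suc m} zero = below zero refl refl
lastView {suc m} (suc i) with lastView i
... | last i≡m eq = last (cong suc i≡m) (cong (M.map suc) eq)
... | below j j≡i eq = below (suc j) (cong suc j≡i) (cong (M.map suc) eq)

toℕ-csuc : ∀ {m} (i : Fin (suc m)) → toℕ (csuc i) ≡ suc (toℕ i) % suc m
toℕ-csuc {m} i with lastView i
... | last i≡m eq rewrite eq | i≡m = sym (n%n≡0 (suc m))
... | below j j≡i eq rewrite eq | sym j≡i = sym (m<n⇒m%n≡m (s≤s (FP.toℕ<n j)))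

csuc-mod : ∀ m j → csuc (j mod suc m) ≡ suc j mod suc m
csuc-mod m j = FP.toℕ-injective (begin
  toℕ (csuc (j mod suc m))         ≡⟨ toℕ-csuc (j mod suc m) ⟩
  suc (toℕ (j mod suc m)) % suc m ≡⟨ cong (λ z → suc z % suc m) (toℕ-mod j (suc m)) ⟩
  (1 + j % suc m) % suc m         ≡⟨ [m+n%d]%d≡[m+n]%d 1 j (suc m) ⟩
  suc j % suc m                   ≡⟨ toℕ-mod (suc j) (suc m) ⟨
  toℕ (suc j mod suc m)           ∎)
  where open ≡-Reasoning

module PrefixCount (m : ℕ) (U : Subset (suc m)) where

  N : ℕ
  N = suc m

  mem : ℕ → Bool
  mem j = lookup U (j mod N)

  P : ℕ → ℕ
  P zero = 0
  P (suc j) = P j + bit (mem j)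

  ∈-arc⁻ : ∀ j l x → x ∈ arc (j mod N) l → ∃ λ i → i < l × x ≡ (j + i) mod N
  ∈-arc⁻ j zero x x∈ = ⊥-elim (SP.∉⊥ x∈)
  ∈-arc⁻ j (suc l) x x∈ with SP.x∈p∪q⁻ ⁅ j mod N ⁆ (arc (csuc (j mod N)) l) x∈
  ... | inj₁ x∈⁅j⁆ =
    0 , z<s , trans (Equivalence.to SP.x∈⁅y⁆⇔x≡y x∈⁅j⁆) (cong (_mod N) (sym (+-identityʳ j)))
  ... | inj₂ x∈arc with ∈-arc⁻ (suc j) l x (subst (λ z → x ∈ arc z l) (csuc-mod m j) x∈arc)
  ...   | i , i<l , x≡ = suc i , s≤s i<l , trans x≡ (cong (_mod N) (sym (+-suc j i)))

  ∈-arc⁺ : ∀ j l i → i < l → (j + i) mod N ∈ arc (j mod N) l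
  ∈-arc⁺ j (suc l) zero _ =
    SP.x∈p∪q⁺ (inj₁ (subst (λ z → z mod N ∈ ⁅ j mod N ⁆) (sym (+-identityʳ j)) (SP.x∈⁅x⁆ (j mod N))))
  ∈-arc⁺ j (suc l) (suc i) (s≤s i<l) = SP.x∈p∪q⁺ {p = ⁅ j mod N ⁆} (inj₂
    (subst₂ (λ z w → z mod N ∈ arc w l) (sym (+-suc j i)) (sym (csuc-mod m j)) (∈-arc⁺ (suc j) l i i<l)))

  ∉-arc-from-suc : ∀ j l → l < N → j mod N ∉ arc (suc j mod N) l
  ∉-arc-from-suc j l l<N j∈ with ∈-arc⁻ (suc j) l (j mod N) j∈
  ... | i , i<l , j≡ = [m+o]%n≢m%n j (suc i) N z<s (<-≤-trans (s≤s i<l) l<N) (sym (begin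
    j % N               ≡⟨ toℕ-mod j N ⟨
    toℕ (j mod N)       ≡⟨ cong toℕ j≡ ⟩
    toℕ ((suc j + i) mod N) ≡⟨ toℕ-mod (suc j + i) N ⟩
    (suc j + i) % N     ≡⟨ cong (_% N) (+-suc j i) ⟨
    (j + suc i) % N     ∎))
    where open ≡-Reasoning

  ∣arc∩U∣+P≡P : ∀ j l → l ≤ N → ∣ arc (j mod N) l ∩ U ∣ + P j ≡ P (j + l)
  ∣arc∩U∣+P≡P j zero _ rewrite ∣⊥∩p∣≡0 U | +-identityʳ j = refl
  ∣arc∩U∣+P≡P j (suc l) l<N = begin
    ∣ (⁅ x ⁆ ∪ A) ∩ U ∣ + P j                         ≡⟨ cong (_+ P j) (+-identityʳ _) ⟨
    ∣ (⁅ x ⁆ ∪ A) ∩ U ∣ + 0 + P j                     ≡⟨ cong (λ z → ∣ (⁅ x ⁆ ∪ A) ∩ U ∣ + z + P j) x∉A∩U ⟨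
    ∣ (⁅ x ⁆ ∪ A) ∩ U ∣ + ∣ ⁅ x ⁆ ∩ (A ∩ U) ∣ + P j ≡⟨ cong (_+ P j) (inclusion-exclusion ⁅ x ⁆ A U) ⟩
    ∣ ⁅ x ⁆ ∩ U ∣ + ∣ A ∩ U ∣ + P j                   ≡⟨ cong (λ z → z + ∣ A ∩ U ∣ + P j) (∣⁅x⁆∩p∣≡bit[x∈p] x U) ⟩
    bit (mem j) + ∣ A ∩ U ∣ + P j                     ≡⟨ a+b+c≡b+[c+a] (bit (mem j)) ∣ A ∩ U ∣ (P j) ⟩
    ∣ A ∩ U ∣ + P (suc j)                             ≡⟨ cong (λ w → ∣ arc w l ∩ U ∣ + P (suc j)) (csuc-mod m j) ⟩
    ∣ arc (suc j mod N) l ∩ U ∣ + P (suc j)           ≡⟨ ∣arc∩U∣+P≡P (suc j) l (<⇒≤ l<N) ⟩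
    P (suc j + l)                                     ≡⟨ cong P (+-suc j l) ⟨
    P (j + suc l)                                     ∎
    where
      open ≡-Reasoning
      x = j mod N
      A = arc (csuc x) l
      x∉A∩U : ∣ ⁅ x ⁆ ∩ (A ∩ U) ∣ ≡ 0
      x∉A∩U rewrite ∣⁅x⁆∩p∣≡bit[x∈p] x (A ∩ U) | VP.lookup-zipWith _∧_ x A U
                  | lookup-∉ (subst (λ w → x ∉ arc w l) (sym (csuc-mod m j)) (∉-arc-from-suc j l l<N)) = refl
      a+b+c≡b+[c+a] : ∀ a b c → a + b + c ≡ b + (c + a)
      a+b+c≡b+[c+a] = solve-∀

  mem-periodic : ∀ j → mem (j + N) ≡ mem j
  mem-periodic j = cong (lookup U) (FP.toℕ-injective (begin
    toℕ ((j + N) mod N) ≡⟨ toℕ-mod (j + N) N ⟩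
    (j + N) % N         ≡⟨ [m+n]%n≡m%n j N ⟩
    j % N               ≡⟨ toℕ-mod j N ⟨
    toℕ (j mod N)       ∎))
    where open ≡-Reasoning

  P-+N : ∀ j → P (j + N) ≡ P j + P N
  P-+N zero = refl
  P-+N (suc j) rewrite P-+N j | mem-periodic j = a+b+c≡a+c+b (P j) (P N) (bit (mem j))
    where
      a+b+c≡a+c+b : ∀ a b c → a + b + c ≡ a + c + b
      a+b+c≡a+c+b = solve-∀

  P-mono : ∀ j l → P j ≤ P (j + l)
  P-mono j zero rewrite +-identityʳ j = ≤-refl
  P-mono j (suc l) rewrite +-suc j l = ≤-trans (P-mono j l) (m≤m+n _ _)

  P-N≡∣U∣ : P N ≡ ∣ U ∣
  P-N≡∣U∣ = begin
    P N                         ≡⟨ ∣arc∩U∣+P≡P 0 N ≤-refl ⟨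
    ∣ arc (0 mod N) N ∩ U ∣ + 0 ≡⟨ +-identityʳ _ ⟩
    ∣ arc (0 mod N) N ∩ U ∣     ≡⟨ cong ∣_∣ whole∩U≡U ⟩
    ∣ U ∣                       ∎
    where
      open ≡-Reasoning
      whole : Subset N
      whole = arc (0 mod N) N
      x∈whole : ∀ x → lookup whole x ≡ true
      x∈whole x = lookup-∈ (subst (_∈ whole) (toℕ-mod-toℕ x) (∈-arc⁺ 0 N (toℕ x) (FP.toℕ<n x)))
      whole∩U≡U : whole ∩ U ≡ U
      whole∩U≡U = subset-ext λ x → trans (VP.lookup-zipWith _∧_ x whole U) (cong (_∧ lookup U x) (x∈whole x))

module Excess (m : ℕ) (U : Subset (suc m)) (k : ℕ) where
  open PrefixCount m U

  -- y ⊑ z says N·P y − k·y ≤ N·P z − k·z, with the subtractions moved across.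
  _⊑_ : ℕ → ℕ → Set
  y ⊑ z = N * P y + k * z ≤ N * P z + k * y

  _⊑?_ : ∀ y z → Dec (y ⊑ z)
  y ⊑? z = _ ≤? _

  ⊑-trans : ∀ {x y z} → x ⊑ y → y ⊑ z → x ⊑ z
  ⊑-trans {x} {y} {z} x⊑y y⊑z = +-cancelʳ-≤ (N * P y + k * y) _ _ (begin
    N * P x + k * z + (N * P y + k * y) ≡⟨ a+b+[c+d]≡a+d+[c+b] (N * P x) (k * z) (N * P y) (k * y) ⟩
    N * P x + k * y + (N * P y + k * z) ≤⟨ +-mono-≤ x⊑y y⊑z ⟩
    N * P y + k * x + (N * P z + k * y) ≡⟨ a+b+[c+d]≡c+b+[a+d] (N * P y) (k * x) (N * P z) (k * y) ⟩
    N * P z + k * x + (N * P y + k * y) ∎)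
    where
      open ≤-Reasoning
      a+b+[c+d]≡a+d+[c+b] : ∀ a b c d → a + b + (c + d) ≡ a + d + (c + b)
      a+b+[c+d]≡a+d+[c+b] = solve-∀
      a+b+[c+d]≡c+b+[a+d] : ∀ a b c d → a + b + (c + d) ≡ c + b + (a + d)
      a+b+[c+d]≡c+b+[a+d] = solve-∀

  argmax : ℕ → ℕ
  argmax zero = 0
  argmax (suc b) with argmax b ⊑? suc b
  ... | yes _ = suc b
  ... | no _ = argmax b

  argmax≤ : ∀ b → argmax b ≤ b
  argmax≤ zero = z≤n
  argmax≤ (suc b) with argmax b ⊑? suc b
  ... | yes _ = ≤-refl
  ... | no _ = m≤n⇒m≤1+n (argmax≤ b)

  ⊑-argmax : ∀ {y} b → y ≤ b → y ⊑ argmax b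
  ⊑-argmax zero z≤n = ≤-refl
  ⊑-argmax {y} (suc b) y≤1+b with argmax b ⊑? suc b | m≤n⇒m<n∨m≡n y≤1+b
  ... | yes a⊑b | inj₁ (s≤s y≤b) = ⊑-trans (⊑-argmax b y≤b) a⊑b
  ... | yes _   | inj₂ refl = ≤-refl
  ... | no _    | inj₁ (s≤s y≤b) = ⊑-argmax b y≤b
  ... | no a⋢b  | inj₂ refl = ≰⇒≥ a⋢b

module Rigidity (m : ℕ) (U : Subset (suc m)) (k : ℕ) (∣U∣≡k : ∣ U ∣ ≡ k) (well-spread : WellSpread U) where
  open PrefixCount m U
  open Excess m U k

  P-+q*N : ∀ j q → P (j + q * N) ≡ P j + q * k
  P-+q*N j zero = trans (cong P (+-identityʳ j)) (sym (+-identityʳ _))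
  P-+q*N j (suc q) = begin
    P (j + (N + q * N)) ≡⟨ cong P (a+[b+c]≡a+c+b j N (q * N)) ⟩
    P (j + q * N + N)   ≡⟨ P-+N (j + q * N) ⟩
    P (j + q * N) + P N ≡⟨ cong₂ _+_ (P-+q*N j q) (trans P-N≡∣U∣ ∣U∣≡k) ⟩
    P j + q * k + k     ≡⟨ a+b+c≡a+[c+b] (P j) (q * k) k ⟩
    P j + (k + q * k)   ∎
    where
      open ≡-Reasoning
      a+[b+c]≡a+c+b : ∀ a b c → a + (b + c) ≡ a + c + b
      a+[b+c]≡a+c+b = solve-∀
      a+b+c≡a+[c+b] : ∀ a b c → a + b + c ≡ a + (c + b)
      a+b+c≡a+[c+b] = solve-∀

  hits : ℕ → ℕ → ℕ
  hits x l = ∣ arc (x mod N) l ∩ U ∣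

  hits≤hits+1 : ∀ x y l → 1 ≤ l → l ≤ m → hits y l ≤ hits x l + 1
  hits≤hits+1 x y l 1≤l l≤m = ∣m-n∣≤o⇒m≤n+o _ _ (well-spread (y mod N) (x mod N) l 1≤l l≤m)

  P-after-arcs : ∀ x l → 1 ≤ l → l ≤ m → ∀ j →
    P (x + l + j * l) ≤ P x + hits x l + j * (hits x l + 1)
  P-after-arcs x l 1≤l l≤m zero = ≤-reflexive (begin
    P (x + l + 0)      ≡⟨ cong P (+-identityʳ (x + l)) ⟩
    P (x + l)          ≡⟨ ∣arc∩U∣+P≡P x l (m≤n⇒m≤1+n l≤m) ⟨
    hits x l + P x     ≡⟨ +-comm (hits x l) (P x) ⟩
    P x + hits x l     ≡⟨ +-identityʳ _ ⟨
    P x + hits x l + 0 ∎)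
    where open ≡-Reasoning
  P-after-arcs x l 1≤l l≤m (suc j) = begin
    P (x + l + (l + j * l))             ≡⟨ cong P (a+b+[b+c]≡a+b+c+b x l (j * l)) ⟩
    P (y + l)                           ≡⟨ ∣arc∩U∣+P≡P y l (m≤n⇒m≤1+n l≤m) ⟨
    hits y l + P y                      ≤⟨ +-mono-≤ (hits≤hits+1 x y l 1≤l l≤m) (P-after-arcs x l 1≤l l≤m j) ⟩
    h + 1 + (P x + h + j * (h + 1))     ≡⟨ a+[b+c+d]≡b+c+[a+d] (h + 1) (P x) h (j * (h + 1)) ⟩
    P x + h + (h + 1 + j * (h + 1))     ∎
    where
      open ≤-Reasoning
      y = x + l + j * l
      h = hits x l
      a+b+[b+c]≡a+b+c+b : ∀ a b c → a + b + (b + c) ≡ a + b + c + b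
      a+b+[b+c]≡a+b+c+b = solve-∀
      a+[b+c+d]≡b+c+[a+d] : ∀ a b c d → a + (b + c + d) ≡ b + c + (a + d)
      a+[b+c+d]≡b+c+[a+d] = solve-∀

  l*k<N*[hits+1] : ∀ x l → 1 ≤ l → l ≤ m → l * k < N * (hits x l + 1)
  l*k<N*[hits+1] x l 1≤l l≤m = +-cancelˡ-< (P x) _ _ (begin-strict
    P x + l * k               ≡⟨ P-+q*N x l ⟨
    P (x + l * N)             ≡⟨ cong P (x+l*[1+m]≡x+l+m*l x l m) ⟩
    P (x + l + m * l)         ≤⟨ P-after-arcs x l 1≤l l≤m m ⟩
    P x + h + m * (h + 1)     <⟨ n<1+n _ ⟩
    suc (P x + h + m * (h + 1)) ≡⟨ 1+[p+h+m*[h+1]]≡p+[1+m]*[h+1] (P x) h m ⟩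
    P x + N * (h + 1)         ∎)
    where
      open ≤-Reasoning
      h = hits x l
      x+l*[1+m]≡x+l+m*l : ∀ x l m → x + l * suc m ≡ x + l + m * l
      x+l*[1+m]≡x+l+m*l = solve-∀
      1+[p+h+m*[h+1]]≡p+[1+m]*[h+1] : ∀ p h m → suc (p + h + m * (h + 1)) ≡ p + suc m * (h + 1)
      1+[p+h+m*[h+1]]≡p+[1+m]*[h+1] = solve-∀

  k*l+N*P[x]<N*P[x+l]+N : ∀ x l → k * l + N * P x < N * P (x + l) + N
  k*l+N*P[x]<N*P[x+l]+N x l =
    subst (λ l → k * l + N * P x < N * P (x + l) + N) (sym (m≡m%n+[m/n]*n l N))
          (remainder (l % N) (l / N) (m%n<n l N))
    where
      open ≤-Reasoning
      remainder : ∀ r q → r < N → k * (r + q * N) + N * P x < N * P (x + (r + q * N)) + N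
      remainder zero q _ = begin-strict
        k * (q * N) + N * P x   ≡⟨ k*[q*N]+N*p≡N*[p+q*k]+0 k q N (P x) ⟩
        N * (P x + q * k) + 0   <⟨ +-monoʳ-< _ z<s ⟩
        N * (P x + q * k) + N   ≡⟨ cong (λ z → N * z + N) (P-+q*N x q) ⟨
        N * P (x + q * N) + N   ∎
        where
          k*[q*N]+N*p≡N*[p+q*k]+0 : ∀ k q N p → k * (q * N) + N * p ≡ N * (p + q * k) + 0
          k*[q*N]+N*p≡N*[p+q*k]+0 = solve-∀
      remainder (suc r) q (s≤s 1+r≤m) = begin-strict
        k * (suc r + q * N) + N * P x       ≡⟨ k*[r+q*N]+N*p≡r*k+[N*p+N*q*k] k (suc r) q N (P x) ⟩
        suc r * k + (N * P x + N * q * k)   <⟨ +-monoˡ-< _ (l*k<N*[hits+1] x (suc r) (s≤s z≤n) 1+r≤m) ⟩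
        N * (h + 1) + (N * P x + N * q * k) ≡⟨ N*[h+1]+[N*p+N*q*k]≡N*[h+p+q*k]+N N h (P x) q k ⟩
        N * (h + P x + q * k) + N           ≡⟨ cong (λ z → N * z + N) P[x+r+q*N] ⟨
        N * P (x + (suc r + q * N)) + N     ∎
        where
          h = hits x (suc r)
          P[x+r+q*N] : P (x + (suc r + q * N)) ≡ h + P x + q * k
          P[x+r+q*N] = begin-equality
            P (x + (suc r + q * N)) ≡⟨ cong P (+-assoc x (suc r) (q * N)) ⟨
            P (x + suc r + q * N)   ≡⟨ P-+q*N (x + suc r) q ⟩
            P (x + suc r) + q * k   ≡⟨ cong (_+ q * k) (∣arc∩U∣+P≡P x (suc r) (m≤n⇒m≤1+n 1+r≤m)) ⟨
            h + P x + q * k         ∎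
          k*[r+q*N]+N*p≡r*k+[N*p+N*q*k] : ∀ k r q N p → k * (r + q * N) + N * p ≡ r * k + (N * p + N * q * k)
          k*[r+q*N]+N*p≡r*k+[N*p+N*q*k] = solve-∀
          N*[h+1]+[N*p+N*q*k]≡N*[h+p+q*k]+N : ∀ N h p q k → N * (h + 1) + (N * p + N * q * k) ≡ N * (h + p + q * k) + N
          N*[h+1]+[N*p+N*q*k]≡N*[h+p+q*k]+N = solve-∀

  x₀ : ℕ
  x₀ = argmax m

  x₀<N : x₀ < N
  x₀<N = s≤s (argmax≤ m)

  -- A maximiser over one period is a global one, since P (y + N) = P y + k.
  ⊑-x₀ : ∀ y → y ⊑ x₀
  ⊑-x₀ y = subst (_⊑ x₀) (sym (m≡m%n+[m/n]*n y N)) (shifted (y % N) (y / N) (m%n<n y N))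
    where
      open ≤-Reasoning
      shifted : ∀ r q → r < N → (r + q * N) ⊑ x₀
      shifted r q (s≤s r≤m) = begin
        N * P (r + q * N) + k * x₀     ≡⟨ cong (λ z → N * z + k * x₀) (P-+q*N r q) ⟩
        N * (P r + q * k) + k * x₀     ≡⟨ N*[p+q*k]+k*x≡N*p+k*x+N*q*k N (P r) q k x₀ ⟩
        N * P r + k * x₀ + N * q * k   ≤⟨ +-monoˡ-≤ (N * q * k) (⊑-argmax m r≤m) ⟩
        N * P x₀ + k * r + N * q * k   ≡⟨ N*p+k*r+N*q*k≡N*p+k*[r+q*N] N (P x₀) k r q ⟩
        N * P x₀ + k * (r + q * N)     ∎
        where
          N*[p+q*k]+k*x≡N*p+k*x+N*q*k : ∀ N p q k x → N * (p + q * k) + k * x ≡ N * p + k * x + N * q * k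
          N*[p+q*k]+k*x≡N*p+k*x+N*q*k = solve-∀
          N*p+k*r+N*q*k≡N*p+k*[r+q*N] : ∀ N p k r q → N * p + k * r + N * q * k ≡ N * p + k * (r + q * N)
          N*p+k*r+N*q*k≡N*p+k*[r+q*N] = solve-∀

  Δ : ℕ → ℕ
  Δ d = P (x₀ + d) ∸ P x₀

  P[x₀+d]≡P[x₀]+Δ : ∀ d → P (x₀ + d) ≡ P x₀ + Δ d
  P[x₀+d]≡P[x₀]+Δ d = sym (m+[n∸m]≡n (P-mono x₀ d))

  N*Δ≤k*d : ∀ d → N * Δ d ≤ k * d
  N*Δ≤k*d d = +-cancelˡ-≤ (N * P x₀ + k * x₀) _ _ (begin
    N * P x₀ + k * x₀ + N * Δ d  ≡⟨ N*p+k*x+N*δ≡N*[p+δ]+k*x N (P x₀) k x₀ (Δ d) ⟩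
    N * (P x₀ + Δ d) + k * x₀    ≡⟨ cong (λ z → N * z + k * x₀) (P[x₀+d]≡P[x₀]+Δ d) ⟨
    N * P (x₀ + d) + k * x₀      ≤⟨ ⊑-x₀ (x₀ + d) ⟩
    N * P x₀ + k * (x₀ + d)      ≡⟨ cong (N * P x₀ +_) (*-distribˡ-+ k x₀ d) ⟩
    N * P x₀ + (k * x₀ + k * d)  ≡⟨ +-assoc (N * P x₀) (k * x₀) (k * d) ⟨
    N * P x₀ + k * x₀ + k * d    ∎)
    where
      open ≤-Reasoning
      N*p+k*x+N*δ≡N*[p+δ]+k*x : ∀ N p k x δ → N * p + k * x + N * δ ≡ N * (p + δ) + k * x
      N*p+k*x+N*δ≡N*[p+δ]+k*x = solve-∀

  k*d<N*Δ+N : ∀ d → k * d < N * Δ d + N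
  k*d<N*Δ+N d = +-cancelʳ-< (N * P x₀) _ _ (begin-strict
    k * d + N * P x₀           <⟨ k*l+N*P[x]<N*P[x+l]+N x₀ d ⟩
    N * P (x₀ + d) + N         ≡⟨ cong (λ z → N * z + N) (P[x₀+d]≡P[x₀]+Δ d) ⟩
    N * (P x₀ + Δ d) + N       ≡⟨ N*[p+δ]+N≡N*δ+N+N*p N (P x₀) (Δ d) ⟩
    N * Δ d + N + N * P x₀     ∎)
    where
      open ≤-Reasoning
      N*[p+δ]+N≡N*δ+N+N*p : ∀ N p δ → N * (p + δ) + N ≡ N * δ + N + N * p
      N*[p+δ]+N≡N*δ+N+N*p = solve-∀

  Δ-suc : ∀ d → Δ (suc d) ≡ Δ d + bit (mem (x₀ + d))
  Δ-suc d = +-cancelˡ-≡ (P x₀) _ _ (begin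
    P x₀ + Δ (suc d)                 ≡⟨ P[x₀+d]≡P[x₀]+Δ (suc d) ⟨
    P (x₀ + suc d)                   ≡⟨ cong P (+-suc x₀ d) ⟩
    P (x₀ + d) + bit (mem (x₀ + d))  ≡⟨ cong (_+ bit (mem (x₀ + d))) (P[x₀+d]≡P[x₀]+Δ d) ⟩
    P x₀ + Δ d + bit (mem (x₀ + d))  ≡⟨ +-assoc (P x₀) (Δ d) _ ⟩
    P x₀ + (Δ d + bit (mem (x₀ + d))) ∎)
    where open ≡-Reasoning

  mem[x₀+d] : ∀ d → mem (x₀ + d) ≡ (N ∸ k ≤ᵇ (k * d) % N)
  mem[x₀+d] d = floor-step-bit N k ((k * d) % N) (Δ d) (mem (x₀ + d))
    (subst₂ _≤_ (cong (N *_) (Δ-suc d)) k*[1+d]≡Δ*N+r+k (N*Δ≤k*d (suc d)))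
    (subst₂ _<_ k*[1+d]≡Δ*N+r+k (cong (λ z → N * z + N) (Δ-suc d)) (k*d<N*Δ+N (suc d)))
    where
      open ≡-Reasoning
      k*[1+d]≡Δ*N+r+k : k * suc d ≡ Δ d * N + (k * d) % N + k
      k*[1+d]≡Δ*N+r+k = begin
        k * suc d                  ≡⟨ *-suc k d ⟩
        k + k * d                  ≡⟨ +-comm k (k * d) ⟩
        k * d + k                  ≡⟨ cong (_+ k) (c*N+x%N≡x N (k * d) (Δ d) (N*Δ≤k*d d) (k*d<N*Δ+N d)) ⟨
        Δ d * N + (k * d) % N + k  ∎

  lookup-U : ∀ x → lookup U x ≡ (N ∸ k ≤ᵇ (k * (toℕ x + N ∸ x₀)) % N)
  lookup-U x = begin
    lookup U x                   ≡⟨ cong (lookup U) (toℕ-mod-toℕ x) ⟨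
    mem (toℕ x)                  ≡⟨ mem-periodic (toℕ x) ⟨
    mem (toℕ x + N)              ≡⟨ cong mem (m+[n∸m]≡n x₀≤x+N) ⟨
    mem (x₀ + (toℕ x + N ∸ x₀))  ≡⟨ mem[x₀+d] (toℕ x + N ∸ x₀) ⟩
    (N ∸ k ≤ᵇ (k * (toℕ x + N ∸ x₀)) % N) ∎
    where
      open ≡-Reasoning
      x₀≤x+N : x₀ ≤ toℕ x + N
      x₀≤x+N = ≤-trans (<⇒≤ x₀<N) (m≤n+m N (toℕ x))

module Residues (a k' : ℕ) (1≤k' : 1 ≤ k') (2k'≤n' : k' + k' ≤ suc a) where

  n' : ℕ
  n' = suc a

  Top : ℕ → Set
  Top u = n' ∸ k' ≤ u

  k'≤n' : k' ≤ n'
  k'≤n' = m+n≤o⇒m≤o k' 2k'≤n'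

  Top-a : Top a
  Top-a = ∸-monoʳ-≤ n' 1≤k'

  k'≤n'∸k' : k' ≤ n' ∸ k'
  k'≤n'∸k' = m+n≤o⇒m≤o∸n k' 2k'≤n'

  Top⇒n'≤u+d : ∀ {u d} → Top u → k' ≤ d → n' ≤ u + d
  Top⇒n'≤u+d {u} {d} top k'≤d = begin
    n'           ≡⟨ m∸n+n≡m k'≤n' ⟨
    n' ∸ k' + k' ≤⟨ +-mono-≤ top k'≤d ⟩
    u + d        ∎
    where open ≤-Reasoning

  carry : ∀ {u} → u < n' → bit (n' ∸ k' ≤ᵇ u) * n' + (u + k') % n' ≡ u + k'
  carry {u} u<n' with n' ∸ k' ≤? u
  ... | yes top rewrite ≤⇒≤ᵇ≡true top = begin
    n' + 0 + (u + k') % n'  ≡⟨ cong₂ _+_ (+-identityʳ n') (n≤m<2n⇒m%n≡m∸n n'≤u+k' (+-mono-<-≤ u<n' k'≤n')) ⟩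
    n' + (u + k' ∸ n')      ≡⟨ m+[n∸m]≡n n'≤u+k' ⟩
    u + k'                  ∎
    where
      open ≡-Reasoning
      n'≤u+k' : n' ≤ u + k'
      n'≤u+k' = Top⇒n'≤u+d top ≤-refl
  ... | no ¬top rewrite ≰⇒≤ᵇ≡false ¬top = m<n⇒m%n≡m (begin-strict
    u + k'        <⟨ +-monoˡ-< k' (≰⇒> ¬top) ⟩
    n' ∸ k' + k'  ≡⟨ m∸n+n≡m k'≤n' ⟩
    n'            ∎)
    where open ≤-Reasoning

  separated : ∀ {u d} → u < n' → k' ≤ d → d ≤ n' ∸ k' → Top u → ¬ Top ((u + d) % n')
  separated {u} {d} u<n' k'≤d d≤n'∸k' top top′ = <-irrefl refl (begin-strict
    n' ∸ k' + n'     ≤⟨ +-monoˡ-≤ n' (subst Top (n≤m<2n⇒m%n≡m∸n n'≤u+d u+d<2n') top′) ⟩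
    u + d ∸ n' + n'  ≡⟨ m∸n+n≡m n'≤u+d ⟩
    u + d            <⟨ +-mono-<-≤ u<n' d≤n'∸k' ⟩
    n' + (n' ∸ k')   ≡⟨ +-comm n' (n' ∸ k') ⟩
    n' ∸ k' + n'     ∎)
    where
      open ≤-Reasoning
      n'≤u+d : n' ≤ u + d
      n'≤u+d = Top⇒n'≤u+d top k'≤d
      u+d<2n' : u + d < n' + n'
      u+d<2n' = +-mono-<-≤ u<n' (≤-trans d≤n'∸k' (m∸n≤m n' k'))

  arcs-overlap : ∀ {d} → d < n' → d < k' ⊎ n' ∸ k' < d → ∃[ u ] u < n' × Top u × Top ((u + d) % n')
  arcs-overlap {d} (s≤s d≤a) (inj₁ d<k') = a ∸ d , s≤s (m∸n≤m a d) , ∸-monoʳ-≤ n' d<k' , top-a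
    where
      top-a : Top ((a ∸ d + d) % n')
      top-a rewrite m∸n+n≡m d≤a | m<n⇒m%n≡m (n<1+n a) = Top-a
  arcs-overlap {d} d<n' (inj₂ n'∸k'<d) = u , u<n' , m≤m+n (n' ∸ k') (n' ∸ d) , top-n'∸k'
    where
      u = n' ∸ k' + (n' ∸ d)
      u<n' : u < n'
      u<n' = begin-strict
        n' ∸ k' + (n' ∸ d) <⟨ +-monoˡ-< (n' ∸ d) n'∸k'<d ⟩
        d + (n' ∸ d)       ≡⟨ m+[n∸m]≡n (<⇒≤ d<n') ⟩
        n'                 ∎
        where open ≤-Reasoning
      top-n'∸k' : Top ((u + d) % n')
      top-n'∸k' = subst Top (sym (begin
        (n' ∸ k' + (n' ∸ d) + d) % n'   ≡⟨ cong (_% n') (+-assoc (n' ∸ k') (n' ∸ d) d) ⟩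
        (n' ∸ k' + (n' ∸ d + d)) % n'   ≡⟨ cong (λ z → (n' ∸ k' + z) % n') (m∸n+n≡m (<⇒≤ d<n')) ⟩
        (n' ∸ k' + n') % n'             ≡⟨ [m+n]%n≡m%n (n' ∸ k') n' ⟩
        (n' ∸ k') % n'                  ≡⟨ m<n⇒m%n≡m (s≤s (∸-monoʳ-≤ n' 1≤k')) ⟩
        n' ∸ k'                         ∎)) ≤-refl
        where open ≡-Reasoning

  shift-invariant⇒0 : ∀ {d} → d < n' → (∀ u → u < n' → Top u ⇔ Top ((u + d) % n')) → d ≡ 0
  shift-invariant⇒0 {zero} _ _ = refl
  shift-invariant⇒0 {suc d} (s≤s d<a) invariant = ⊥-elim (<-irrefl refl (begin-strict
    n'                              ≡⟨ m∸n+n≡m k'≤n' ⟨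
    n' ∸ k' + k'                    ≤⟨ +-monoʳ-≤ (n' ∸ k') k'≤n'∸k' ⟩
    n' ∸ k' + (n' ∸ k')             ≤⟨ +-mono-≤ top-d top-a∸1+d ⟩
    d + (a ∸ suc d)                 ≤⟨ +-monoʳ-≤ d (∸-monoʳ-≤ a (n≤1+n d)) ⟩
    d + (a ∸ d)                     ≡⟨ m+[n∸m]≡n (<⇒≤ d<a) ⟩
    a                               <⟨ n<1+n a ⟩
    n'                              ∎))
    where
      open ≤-Reasoning
      [a+1+d]%n'≡d : (a + suc d) % n' ≡ d
      [a+1+d]%n'≡d = trans (cong (_% n') (trans (+-suc a d) (+-comm n' d)))
                           (trans ([m+n]%n≡m%n d n') (m<n⇒m%n≡m (m≤n⇒m≤1+n d<a)))
      [a∸[1+d]+1+d]%n'≡a : (a ∸ suc d + suc d) % n' ≡ a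
      [a∸[1+d]+1+d]%n'≡a = trans (cong (_% n') (m∸n+n≡m d<a)) (m<n⇒m%n≡m (n<1+n a))
      top-d : Top d
      top-d = subst Top [a+1+d]%n'≡d (Equivalence.to (invariant a (n<1+n a)) Top-a)
      top-a∸1+d : Top (a ∸ suc d)
      top-a∸1+d = Equivalence.from (invariant (a ∸ suc d) (s≤s (m∸n≤m a (suc d))))
                                   (subst Top (sym [a∸[1+d]+1+d]%n'≡a) Top-a)

module Canonical (m a g' k' : ℕ) (N≡n'*g : suc m ≡ suc a * suc g')
                 (1≤k' : 1 ≤ k') (2k'≤n' : k' + k' ≤ suc a) (coprime : gcd k' (suc a) ≡ 1) where
  open Residues a k' 1≤k' 2k'≤n'

  N g k : ℕ
  N = suc m
  g = suc g'
  k = k' * g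

  pos : ℕ → ℕ → ℕ
  pos τ j = (k' * j + τ) % n'

  pos<n' : ∀ τ j → pos τ j < n'
  pos<n' τ j = m%n<n (k' * j + τ) n'

  -- x ∈ Can τ iff ⌊(k'·x + τ)/n'⌋ jumps between x and x + 1.
  Can : ℕ → Subset N
  Can τ = tabulate λ x → n' ∸ k' ≤ᵇ pos τ (toℕ x)

  lookup-Can : ∀ τ x → lookup (Can τ) x ≡ (n' ∸ k' ≤ᵇ pos τ (toℕ x))
  lookup-Can τ x = VP.lookup∘tabulate (λ x → n' ∸ k' ≤ᵇ pos τ (toℕ x)) x

  ∈Can⇔Top : ∀ τ x → x ∈ Can τ ⇔ Top (pos τ (toℕ x))
  ∈Can⇔Top τ x = mk⇔ (λ x∈ → ≤ᵇ≡true⇒≤ (trans (sym (lookup-Can τ x)) (lookup-∈ x∈)))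
                     (λ top → ∈-lookup (trans (lookup-Can τ x) (≤⇒≤ᵇ≡true top)))

  pos-%N : ∀ τ j → pos τ (j % N) ≡ pos τ j
  pos-%N τ j = sym (begin
    (k' * j + τ) % n'                                ≡⟨ cong (λ z → (k' * z + τ) % n') j≡ ⟩
    (k' * (j % N + j / N * (n' * g)) + τ) % n'       ≡⟨ cong (_% n') (k*[r+q*[n*g]]+τ≡k*r+τ+k*q*g*n k' (j % N) (j / N) τ n' g) ⟩
    (k' * (j % N) + τ + k' * (j / N) * g * n') % n' ≡⟨ [m+kn]%n≡m%n (k' * (j % N) + τ) (k' * (j / N) * g) n' ⟩
    (k' * (j % N) + τ) % n'                          ∎)
    where
      open ≡-Reasoning
      j≡ : j ≡ j % N + j / N * (n' * g)
      j≡ = trans (m≡m%n+[m/n]*n j N) (cong (λ z → j % N + j / N * z) N≡n'*g)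
      k*[r+q*[n*g]]+τ≡k*r+τ+k*q*g*n : ∀ k r q τ n g → k * (r + q * (n * g)) + τ ≡ k * r + τ + k * q * g * n
      k*[r+q*[n*g]]+τ≡k*r+τ+k*q*g*n = solve-∀

  pos-+ : ∀ τ d j → pos (τ + d) j ≡ (pos τ j + d) % n'
  pos-+ τ d j = begin
    (k' * j + (τ + d)) % n' ≡⟨ cong (_% n') (+-assoc (k' * j) τ d) ⟨
    (k' * j + τ + d) % n'   ≡⟨ [m%d+n]%d≡[m+n]%d (k' * j + τ) d n' ⟨
    (pos τ j + d) % n'      ∎
    where open ≡-Reasoning

  pos-suc : ∀ τ j → pos τ (suc j) ≡ (pos τ j + k') % n'
  pos-suc τ j = begin
    (k' * suc j + τ) % n'   ≡⟨ cong (_% n') (k*[1+j]+τ≡k*j+τ+k k' j τ) ⟩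
    (k' * j + τ + k') % n'  ≡⟨ [m%d+n]%d≡[m+n]%d (k' * j + τ) k' n' ⟨
    (pos τ j + k') % n'     ∎
    where
      open ≡-Reasoning
      k*[1+j]+τ≡k*j+τ+k : ∀ k j τ → k * suc j + τ ≡ k * j + τ + k
      k*[1+j]+τ≡k*j+τ+k = solve-∀

  rescale : ∀ d → (N ∸ k ≤ᵇ (k * d) % N) ≡ (n' ∸ k' ≤ᵇ (k' * d) % n')
  rescale d = begin
    (N ∸ k ≤ᵇ (k * d) % N)                 ≡⟨ cong₂ _≤ᵇ_ N∸k≡[n'∸k']*g k*d%N≡[k'*d%n']*g ⟩
    ((n' ∸ k') * g ≤ᵇ (k' * d) % n' * g)  ≡⟨ [m*o≤ᵇn*o]≡[m≤ᵇn] (n' ∸ k') ((k' * d) % n') g ⟩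
    (n' ∸ k' ≤ᵇ (k' * d) % n')             ∎
    where
      open ≡-Reasoning
      N∸k≡[n'∸k']*g : N ∸ k ≡ (n' ∸ k') * g
      N∸k≡[n'∸k']*g = trans (cong (_∸ k) N≡n'*g) (sym (*-distribʳ-∸ g n' k'))
      k*g*d≡k*d*g : ∀ k g d → k * g * d ≡ k * d * g
      k*g*d≡k*d*g = solve-∀
      k*d%N≡[k'*d%n']*g : (k * d) % N ≡ (k' * d) % n' * g
      k*d%N≡[k'*d%n']*g = begin
        (k' * g * d) % N       ≡⟨ cong (_% N) (k*g*d≡k*d*g k' g d) ⟩
        (k' * d * g) % N       ≡⟨ %-congʳ {o = k' * d * g} N≡n'*g ⟩
        (k' * d * g) % (n' * g) ≡⟨ m%n*o≡m*o%[n*o] (k' * d) n' g ⟨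
        (k' * d) % n' * g      ∎

  phase : Subset N → ℕ
  phase U = (k' * (N ∸ Excess.argmax m U k m)) % n'

  rigid : ∀ U → ∣ U ∣ ≡ k → WellSpread U → U ≡ Can (phase U)
  rigid U ∣U∣≡k well-spread = subset-ext λ x → begin
    lookup U x                                 ≡⟨ lookup-U x ⟩
    (N ∸ k ≤ᵇ (k * (toℕ x + N ∸ x₀)) % N)      ≡⟨ rescale (toℕ x + N ∸ x₀) ⟩
    (n' ∸ k' ≤ᵇ (k' * (toℕ x + N ∸ x₀)) % n')  ≡⟨ cong (n' ∸ k' ≤ᵇ_) (shift x) ⟩
    (n' ∸ k' ≤ᵇ pos (phase U) (toℕ x))         ≡⟨ lookup-Can (phase U) x ⟨
    lookup (Can (phase U)) x                   ∎
    where
      open ≡-Reasoning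
      open Rigidity m U k ∣U∣≡k well-spread
      shift : ∀ x → (k' * (toℕ x + N ∸ x₀)) % n' ≡ pos (phase U) (toℕ x)
      shift x = begin
        (k' * (toℕ x + N ∸ x₀)) % n'            ≡⟨ cong (λ z → (k' * z) % n') (+-∸-assoc (toℕ x) (<⇒≤ x₀<N)) ⟩
        (k' * (toℕ x + (N ∸ x₀))) % n'          ≡⟨ cong (_% n') (*-distribˡ-+ k' (toℕ x) (N ∸ x₀)) ⟩
        (k' * toℕ x + k' * (N ∸ x₀)) % n'       ≡⟨ [m+n%d]%d≡[m+n]%d (k' * toℕ x) (k' * (N ∸ x₀)) n' ⟨
        (k' * toℕ x + phase U) % n'             ∎

  pos-surjective : ∀ τ u → τ ≤ n' → u < n' → ∃ λ (x : Fin N) → pos τ (toℕ x) ≡ u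
  pos-surjective τ u τ≤n' u<n' = w mod N , (begin
    pos τ (toℕ (w mod N))              ≡⟨ cong (pos τ) (toℕ-mod w N) ⟩
    pos τ (w % N)                      ≡⟨ pos-%N τ w ⟩
    (k' * w + τ) % n'                  ≡⟨ [m%d+n]%d≡[m+n]%d (k' * w) τ n' ⟨
    ((k' * w) % n' + τ) % n'           ≡⟨ cong (λ z → (z + τ) % n') k'w≡ ⟩
    ((u + (n' ∸ τ)) % n' + τ) % n'     ≡⟨ [m%d+n]%d≡[m+n]%d (u + (n' ∸ τ)) τ n' ⟩
    (u + (n' ∸ τ) + τ) % n'            ≡⟨ cong (_% n') (trans (+-assoc u (n' ∸ τ) τ) (cong (u +_) (m∸n+n≡m τ≤n'))) ⟩
    (u + n') % n'                      ≡⟨ [m+n]%n≡m%n u n' ⟩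
    u % n'                             ≡⟨ m<n⇒m%n≡m u<n' ⟩
    u                                  ∎)
    where
      open ≡-Reasoning
      w = proj₁ (*-surjective-mod k' a coprime (u + (n' ∸ τ)))
      k'w≡ = proj₂ (*-surjective-mod k' a coprime (u + (n' ∸ τ)))

  pos-shift : ∀ {s t} → s ≤ t → ∀ j → pos t j ≡ (pos s j + (t ∸ s)) % n'
  pos-shift {s} {t} s≤t j = trans (cong (λ z → pos z j) (sym (m+[n∸m]≡n s≤t))) (pos-+ s (t ∸ s) j)

  witness : ∀ {s t} → s ≤ t → t < n' → ∀ u → u < n' →
    ∃ λ x → (x ∈ Can s ⇔ Top u) × (x ∈ Can t ⇔ Top ((u + (t ∸ s)) % n'))
  witness {s} {t} s≤t t<n' u u<n' = x , transport s pos≡u , transport t pos-t≡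
    where
      x : Fin N
      x = proj₁ (pos-surjective s u (≤-trans s≤t (<⇒≤ t<n')) u<n')
      pos≡u : pos s (toℕ x) ≡ u
      pos≡u = proj₂ (pos-surjective s u (≤-trans s≤t (<⇒≤ t<n')) u<n')
      pos-t≡ : pos t (toℕ x) ≡ (u + (t ∸ s)) % n'
      pos-t≡ = trans (pos-shift s≤t (toℕ x)) (cong (λ z → (z + (t ∸ s)) % n') pos≡u)
      transport : ∀ τ {v} → pos τ (toℕ x) ≡ v → x ∈ Can τ ⇔ Top v
      transport τ eq = mk⇔ (λ x∈ → subst Top eq (Equivalence.to (∈Can⇔Top τ x) x∈))
                           (λ top → Equivalence.from (∈Can⇔Top τ x) (subst Top (sym eq) top))

  Disjoint : Subset N → Subset N → Set
  Disjoint p q = ∀ x → x ∈ p → x ∉ q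

  Can-disjoint⇔ : ∀ {s t} → s ≤ t → t < n' →
    Disjoint (Can s) (Can t) ⇔ (k' ≤ t ∸ s × t ∸ s ≤ n' ∸ k')
  Can-disjoint⇔ {s} {t} s≤t t<n' = mk⇔ separation disjointness
    where
      d : ℕ
      d = t ∸ s
      d<n' : d < n'
      d<n' = ≤-<-trans (m∸n≤m t s) t<n'
      no-overlap : Disjoint (Can s) (Can t) → ¬ (d < k' ⊎ n' ∸ k' < d)
      no-overlap D near = D x (Equivalence.from x∈s⇔ top-u) (Equivalence.from x∈t⇔ top-u+d)
        where
          open Σ (arcs-overlap d<n' near) renaming (proj₁ to u; proj₂ to u-props)
          top-u : Top u
          top-u = proj₁ (proj₂ u-props)
          top-u+d : Top ((u + d) % n')
          top-u+d = proj₂ (proj₂ u-props)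
          open Σ (witness s≤t t<n' u (proj₁ u-props)) renaming (proj₁ to x; proj₂ to x-props)
          x∈s⇔ : x ∈ Can s ⇔ Top u
          x∈s⇔ = proj₁ x-props
          x∈t⇔ : x ∈ Can t ⇔ Top ((u + d) % n')
          x∈t⇔ = proj₂ x-props
      separation : Disjoint (Can s) (Can t) → k' ≤ d × d ≤ n' ∸ k'
      separation D = ≮⇒≥ (no-overlap D ∘′ inj₁) , ≮⇒≥ (no-overlap D ∘′ inj₂)
      disjointness : k' ≤ d × d ≤ n' ∸ k' → Disjoint (Can s) (Can t)
      disjointness (k'≤d , d≤n'∸k') x x∈s x∈t =
        separated (pos<n' s (toℕ x)) k'≤d d≤n'∸k' (Equivalence.to (∈Can⇔Top s x) x∈s)
                  (subst Top (pos-shift s≤t (toℕ x)) (Equivalence.to (∈Can⇔Top t x) x∈t))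

  Can-injective-≤ : ∀ {s t} → s ≤ t → t < n' → Can s ≡ Can t → s ≡ t
  Can-injective-≤ {s} {t} s≤t t<n' eq =
    ≤-antisym s≤t (m∸n≡0⇒m≤n (shift-invariant⇒0 (≤-<-trans (m∸n≤m t s) t<n') invariant))
    where
      invariant : ∀ u → u < n' → Top u ⇔ Top ((u + (t ∸ s)) % n')
      invariant u u<n' = mk⇔ (λ top → Equivalence.to x∈t⇔ (subst (x ∈_) eq (Equivalence.from x∈s⇔ top)))
                             (λ top → Equivalence.to x∈s⇔ (subst (x ∈_) (sym eq) (Equivalence.from x∈t⇔ top)))
        where
          open Σ (witness s≤t t<n' u u<n') renaming (proj₁ to x; proj₂ to x-props)
          x∈s⇔ : x ∈ Can s ⇔ Top u
          x∈s⇔ = proj₁ x-props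
          x∈t⇔ : x ∈ Can t ⇔ Top ((u + (t ∸ s)) % n')
          x∈t⇔ = proj₂ x-props

  Can-injective : ∀ {s t} → s < n' → t < n' → Can s ≡ Can t → s ≡ t
  Can-injective {s} {t} s<n' t<n' eq with ≤-total s t
  ... | inj₁ s≤t = Can-injective-≤ s≤t t<n' eq
  ... | inj₂ t≤s = sym (Can-injective-≤ t≤s s<n' (sym eq))

  module CanVertex (τ : ℕ) (τ<n' : τ < n') where
    open PrefixCount m (Can τ) hiding (N)

    mem-Can : ∀ j → mem j ≡ (n' ∸ k' ≤ᵇ pos τ j)
    mem-Can j = begin
      lookup (Can τ) (j mod N)             ≡⟨ lookup-Can τ (j mod N) ⟩
      (n' ∸ k' ≤ᵇ pos τ (toℕ (j mod N)))   ≡⟨ cong (λ z → n' ∸ k' ≤ᵇ pos τ z) (toℕ-mod j N) ⟩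
      (n' ∸ k' ≤ᵇ pos τ (j % N))           ≡⟨ cong (n' ∸ k' ≤ᵇ_) (pos-%N τ j) ⟩
      (n' ∸ k' ≤ᵇ pos τ j)                 ∎
      where open ≡-Reasoning

    P*n'+pos≡k'*j+τ : ∀ j → P j * n' + pos τ j ≡ k' * j + τ
    P*n'+pos≡k'*j+τ zero rewrite *-zeroʳ k' = m<n⇒m%n≡m τ<n'
    P*n'+pos≡k'*j+τ (suc j) = begin
      (P j + bit (mem j)) * n' + pos τ (suc j)   ≡⟨ cong₂ (λ b r → (P j + bit b) * n' + r) (mem-Can j) (pos-suc τ j) ⟩
      (P j + bit b) * n' + (r + k') % n'         ≡⟨ [p+b]*n+q≡p*n+[b*n+q] (P j) (bit b) n' ((r + k') % n') ⟩
      P j * n' + (bit b * n' + (r + k') % n')    ≡⟨ cong (P j * n' +_) (carry (pos<n' τ j)) ⟩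
      P j * n' + (r + k')                        ≡⟨ +-assoc (P j * n') r k' ⟨
      P j * n' + r + k'                          ≡⟨ cong (_+ k') (P*n'+pos≡k'*j+τ j) ⟩
      k' * j + τ + k'                            ≡⟨ k*[1+j]+τ≡k*j+τ+k k' j τ ⟨
      k' * suc j + τ                             ∎
      where
        open ≡-Reasoning
        r = pos τ j
        b = n' ∸ k' ≤ᵇ r
        [p+b]*n+q≡p*n+[b*n+q] : ∀ p b n q → (p + b) * n + q ≡ p * n + (b * n + q)
        [p+b]*n+q≡p*n+[b*n+q] = solve-∀
        k*[1+j]+τ≡k*j+τ+k : ∀ k j τ → k * suc j + τ ≡ k * j + τ + k
        k*[1+j]+τ≡k*j+τ+k = solve-∀

    ∣Can∣≡k : ∣ Can τ ∣ ≡ k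
    ∣Can∣≡k = trans (sym P-N≡∣U∣) (*-cancelʳ-≡ (P N) k n' (+-cancelʳ-≡ τ (P N * n') (k * n') (begin
      P N * n' + τ         ≡⟨ cong (P N * n' +_) pos-N ⟨
      P N * n' + pos τ N   ≡⟨ P*n'+pos≡k'*j+τ N ⟩
      k' * N + τ           ≡⟨ cong (λ z → k' * z + τ) N≡n'*g ⟩
      k' * (n' * g) + τ    ≡⟨ k*[n*g]+τ≡k*g*n+τ k' n' g τ ⟩
      k * n' + τ           ∎)))
      where
        open ≡-Reasoning
        k*[n*g]+τ≡k*g*n+τ : ∀ k n g τ → k * (n * g) + τ ≡ k * g * n + τ
        k*[n*g]+τ≡k*g*n+τ = solve-∀
        pos-N : pos τ N ≡ τ
        pos-N = begin
          (k' * N + τ) % n'           ≡⟨ cong (λ z → (k' * z + τ) % n') N≡n'*g ⟩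
          (k' * (n' * g) + τ) % n'    ≡⟨ cong (_% n') (trans (k*[n*g]+τ≡k*g*n+τ k' n' g τ) (+-comm (k * n') τ)) ⟩
          (τ + k * n') % n'           ≡⟨ [m+kn]%n≡m%n τ k n' ⟩
          τ % n'                      ≡⟨ m<n⇒m%n≡m τ<n' ⟩
          τ                           ∎

    Can-stable : CycStable (Can τ)
    Can-stable i i∈ csuc[i]∈ = separated (pos<n' τ (toℕ i)) ≤-refl k'≤n'∸k' (Equivalence.to (∈Can⇔Top τ i) i∈)
      (subst Top pos-csuc (Equivalence.to (∈Can⇔Top τ (csuc i)) csuc[i]∈))
      where
        pos-csuc : pos τ (toℕ (csuc i)) ≡ (pos τ (toℕ i) + k') % n'
        pos-csuc = trans (cong (pos τ) (toℕ-csuc i)) (trans (pos-%N τ (suc (toℕ i))) (pos-suc τ (toℕ i)))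

    ∣arc∩Can∣*n'+pos : ∀ x l → l ≤ N →
      ∣ arc x l ∩ Can τ ∣ * n' + pos τ (toℕ x + l) ≡ k' * l + pos τ (toℕ x)
    ∣arc∩Can∣*n'+pos x l l≤N = +-cancelʳ-≡ (P (toℕ x) * n') _ _ (begin
      c * n' + pos τ (toℕ x + l) + P (toℕ x) * n'  ≡⟨ c*n+r+p*n≡[c+p]*n+r c n' (pos τ (toℕ x + l)) (P (toℕ x)) ⟩
      (c + P (toℕ x)) * n' + pos τ (toℕ x + l)     ≡⟨ cong (λ z → z * n' + pos τ (toℕ x + l)) c+P≡P ⟩
      P (toℕ x + l) * n' + pos τ (toℕ x + l)       ≡⟨ P*n'+pos≡k'*j+τ (toℕ x + l) ⟩
      k' * (toℕ x + l) + τ                         ≡⟨ k*[x+l]+τ≡k*l+[k*x+τ] k' (toℕ x) l τ ⟩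
      k' * l + (k' * toℕ x + τ)                    ≡⟨ cong (k' * l +_) (P*n'+pos≡k'*j+τ (toℕ x)) ⟨
      k' * l + (P (toℕ x) * n' + pos τ (toℕ x))    ≡⟨ a+[b+c]≡a+c+b (k' * l) (P (toℕ x) * n') (pos τ (toℕ x)) ⟩
      k' * l + pos τ (toℕ x) + P (toℕ x) * n'      ∎)
      where
        open ≡-Reasoning
        c = ∣ arc x l ∩ Can τ ∣
        c+P≡P : c + P (toℕ x) ≡ P (toℕ x + l)
        c+P≡P = subst (λ w → ∣ arc w l ∩ Can τ ∣ + P (toℕ x) ≡ P (toℕ x + l)) (toℕ-mod-toℕ x)
                      (∣arc∩U∣+P≡P (toℕ x) l l≤N)
        c*n+r+p*n≡[c+p]*n+r : ∀ c n r p → c * n + r + p * n ≡ (c + p) * n + r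
        c*n+r+p*n≡[c+p]*n+r = solve-∀
        k*[x+l]+τ≡k*l+[k*x+τ] : ∀ k x l τ → k * (x + l) + τ ≡ k * l + (k * x + τ)
        k*[x+l]+τ≡k*l+[k*x+τ] = solve-∀
        a+[b+c]≡a+c+b : ∀ a b c → a + (b + c) ≡ a + c + b
        a+[b+c]≡a+c+b = solve-∀

    Can-well-spread : WellSpread (Can τ)
    Can-well-spread x y l _ l≤m = ∣m-n∣≤o _ _ (close x y) (close y x)
      where
        close : ∀ x y → ∣ arc x l ∩ Can τ ∣ ≤ ∣ arc y l ∩ Can τ ∣ + 1
        close x y = quotients-close n' (k' * l) (pos<n' τ (toℕ x)) (pos<n' τ (toℕ y + l))
          (∣arc∩Can∣*n'+pos x l (m≤n⇒m≤1+n l≤m)) (∣arc∩Can∣*n'+pos y l (m≤n⇒m≤1+n l≤m))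

qv-ext : ∀ {n k} {u v : QVertex n k} → set u ≡ set v → u ≡ v
qv-ext {u = qv U _ _ _} {qv .U _ _ _} refl = refl

module Isomorphism (m a g' k' : ℕ) (N≡n'*g : suc m ≡ suc a * suc g')
                   (1≤k' : 1 ≤ k') (2k'≤n' : k' + k' ≤ suc a) (coprime : gcd k' (suc a) ≡ 1) where
  open Residues a k' 1≤k' 2k'≤n'
  open Canonical m a g' k' N≡n'*g 1≤k' 2k'≤n' coprime

  phase<n' : ∀ U → phase U < n'
  phase<n' U = m%n<n (k' * (N ∸ Excess.argmax m U k m)) n'

  to : QVertex N k → Fin n'
  to u = fromℕ< (phase<n' (set u))

  -- The size and spread fields are irrelevant; the equation is recomputed from decidability of ≡.
  set≡Can : ∀ u → set u ≡ Can (toℕ (to u))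
  set≡Can (qv U ∣U∣≡k _ well-spread) =
    trans (recompute (VP.≡-dec _≟ᵇ_ U (Can (phase U))) (rigid U ∣U∣≡k well-spread))
          (cong Can (sym (FP.toℕ-fromℕ< (phase<n' U))))

  from : Fin n' → QVertex N k
  from t = qv (Can (toℕ t)) ∣Can∣≡k Can-stable Can-well-spread
    where open CanVertex (toℕ t) (FP.toℕ<n t)

  to-injective : ∀ {u v} → to u ≡ to v → u ≡ v
  to-injective {u} {v} eq = qv-ext (trans (set≡Can u) (trans (cong (Can ∘′ toℕ) eq) (sym (set≡Can v))))

  to-from : ∀ t → to (from t) ≡ t
  to-from t = FP.toℕ-injective (Can-injective (FP.toℕ<n (to (from t))) (FP.toℕ<n t) (sym (set≡Can (from t))))

  Disjoint-sym : ∀ {p q} → Disjoint p q ⇔ Disjoint q p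
  Disjoint-sym = mk⇔ (λ D x x∈q x∈p → D x x∈p x∈q) (λ D x x∈p x∈q → D x x∈q x∈p)

  Can-disjoint⇔Adj : ∀ i j → Disjoint (Can (toℕ i)) (Can (toℕ j)) ⇔ Adj (Kcirc n' k') i j
  Can-disjoint⇔Adj i j with ≤-total (toℕ i) (toℕ j)
  ... | inj₁ i≤j rewrite m≤n⇒∣m-n∣≡n∸m i≤j = Can-disjoint⇔ i≤j (FP.toℕ<n j)
  ... | inj₂ j≤i rewrite m≤n⇒∣n-m∣≡n∸m j≤i = ⇔.trans Disjoint-sym (Can-disjoint⇔ j≤i (FP.toℕ<n i))

  Q≅Kcirc : Iso (Q N k) (Kcirc n' k')
  Q≅Kcirc = mk⤖ (to-injective , λ t → from t , λ { refl → to-from t }) , adjacency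
    where
      adjacency : ∀ u v → Adj (Q N k) u v ⇔ Adj (Kcirc n' k') (to u) (to v)
      adjacency u v = subst₂ (λ p q → Disjoint p q ⇔ Adj (Kcirc n' k') (to u) (to v))
                             (sym (set≡Can u)) (sym (set≡Can v)) (Can-disjoint⇔Adj (to u) (to v))

gcd[k′,n′]≡1 : ∀ n k n' k' → 1 ≤ k → n ≡ n' * gcd n k → k ≡ k' * gcd n k → gcd k' n' ≡ 1
gcd[k′,n′]≡1 n k n' k' 1≤k n≡ k≡ =
  trans (gcd-comm k' n') (*-cancelˡ-≡ (gcd n' k') 1 G {{≢-nonZero G≢0}} (begin
    G * gcd n' k'          ≡⟨ c*gcd[m,n]≡gcd[cm,cn] G n' k' ⟩
    gcd (G * n') (G * k')  ≡⟨ cong₂ gcd (trans (*-comm G n') (sym n≡)) (trans (*-comm G k') (sym k≡)) ⟩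
    G                      ≡⟨ *-identityʳ G ⟨
    G * 1                  ∎))
  where
    open ≡-Reasoning
    G = gcd n k
    G≢0 : G ≢ 0
    G≢0 = gcd[m,n]≢0 n k (inj₂ (λ k≡0 → <-irrefl refl (subst (1 ≤_) k≡0 1≤k)))

Q≅Kcirc-scaled : ∀ m k n' k' g → 1 ≤ k → 2 * k ≤ suc m → suc m ≡ n' * g → k ≡ k' * g → gcd k' n' ≡ 1 →
  Iso (Q (suc m) k) (Kcirc n' k')
Q≅Kcirc-scaled m k zero k' g _ _ () _ _
Q≅Kcirc-scaled m k (suc a) k' zero _ _ N≡ _ _ with trans N≡ (*-zeroʳ (suc a))
... | ()
Q≅Kcirc-scaled m (suc _) (suc a) zero (suc g') _ _ _ () _
Q≅Kcirc-scaled m k (suc a) k'@(suc _) (suc g') _ 2k≤N N≡ k≡ coprime =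
  subst (λ k → Iso (Q (suc m) k) (Kcirc (suc a) k')) (sym k≡)
        (Isomorphism.Q≅Kcirc m a g' k' N≡ (s≤s z≤n) 2k'≤n' coprime)
  where
    open ≤-Reasoning
    2k'≤n' : k' + k' ≤ suc a
    2k'≤n' = *-cancelʳ-≤ (k' + k') (suc a) (suc g') (begin
      (k' + k') * suc g'  ≡⟨ [k+k]*g≡2*[k*g] k' (suc g') ⟩
      2 * (k' * suc g')   ≡⟨ cong (2 *_) k≡ ⟨
      2 * k               ≤⟨ 2k≤N ⟩
      suc m               ≡⟨ N≡ ⟩
      suc a * suc g'      ∎)
      where
        [k+k]*g≡2*[k*g] : ∀ k g → (k + k) * g ≡ 2 * (k * g)
        [k+k]*g≡2*[k*g] = solve-∀

corollary24 : (n k n' k' : ℕ) → 1 ≤ k → 2 * k ≤ n →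
    n ≡ n' * gcd n k → k ≡ k' * gcd n k →
    Iso (Q n k) (Kcirc n' k')
corollary24 zero (suc k) n' k' _ () _ _
corollary24 (suc m) k n' k' 1≤k 2k≤n n≡ k≡ =
  Q≅Kcirc-scaled m k n' k' (gcd (suc m) k) 1≤k 2k≤n n≡ k≡ (gcd[k′,n′]≡1 (suc m) k n' k' 1≤k n≡ k≡)
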